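{- For any positive integers $a$, $b$, and $c$ such that $b$ divides $c$, we have $$(\gcd(a,c)+\mathrm{lcm}(a,c))-(\gcd(a,b)+\mathrm{lcm}(a,b))\geq \frac{c}{b}-1.$$ -}

module Defs where

-- Put g = gcd a b, L = lcm a b, g' = gcd a c, L' = lcm a c. Since b ∣ c we have g' = u g
-- and L' = v L, and comparing g' L' = a c with g L = a b gives u v = c / b. Moreover u ∣ g' ∣ a ∣ L,
-- so u ≤ L. The claim g + L + u v ≤ u g + v L + 1 then follows from u + g ≤ u g + 1 and
-- u (v - 1) ≤ L (v - 1).
module Submission where

open import Defs
open import Data.Nat using (ℕ; suc; _/_; NonZero)
open import Data.Nat.Divisibility using (_∣_)
open import Data.Nat.GCD using (gcd)
open import Data.Nat.LCM using (lcm)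
open import Data.Integer using (ℤ; +_; _+_; _-_; _≥_)

import Data.Nat as ℕ
open import Data.Nat using (_*_; _≤_; ≢-nonZero; ≢-nonZero⁻¹)
open import Data.Nat.Properties
  using (+-mono-≤; +-monoˡ-≤; +-monoʳ-≤; *-monoˡ-≤; m≤m*n; m*n≢0; m*n≢0⇒n≢0; *-cancelʳ-≡
        ; module ≤-Reasoning)
open import Data.Nat.Divisibility
  using (divides; quotient-∣; quotient≢0; ∣-trans; ∣⇒≤)
open import Data.Nat.DivMod using (m*n/n≡m)
open import Data.Nat.GCD using (gcd[m,n]∣m; gcd[m,n]∣n; gcd-greatest; gcd[m,n]≢0)
open import Data.Nat.LCM using (m∣lcm[m,n]; n∣lcm[m,n]; lcm-least; gcd*lcm)
open import Data.List.Base using (_∷_; [])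
import Data.Nat.Tactic.RingSolver as ℕ-Solver
import Data.Integer as ℤ
import Data.Integer.Properties as ℤ
import Data.Integer.Tactic.RingSolver as ℤ-Solver
open import Data.Sum using (inj₁)
open import Function.Base using (it)
open import Relation.Binary.PropositionalEquality
  using (_≡_; refl; sym; cong; cong₂; subst; subst₂; module ≡-Reasoning)

gcd≢0ˡ : ∀ m n .{{_ : NonZero m}} → NonZero (gcd m n)
gcd≢0ˡ m n = ≢-nonZero (gcd[m,n]≢0 m n (inj₁ (≢-nonZero⁻¹ m)))

gcd*lcm≢0 : ∀ m n .{{_ : NonZero m}} .{{_ : NonZero n}} → NonZero (gcd m n * lcm m n)
gcd*lcm≢0 m n = subst NonZero (sym (gcd*lcm m n)) (m*n≢0 m n)

lcm≢0 : ∀ m n .{{_ : NonZero m}} .{{_ : NonZero n}} → NonZero (lcm m n)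
lcm≢0 m n = m*n≢0⇒n≢0 (gcd m n) {{gcd*lcm≢0 m n}}

gcd-monoʳ-∣ : ∀ m {n o} → n ∣ o → gcd m n ∣ gcd m o
gcd-monoʳ-∣ m n∣o = gcd-greatest (gcd[m,n]∣m m _) (∣-trans (gcd[m,n]∣n m _) n∣o)

lcm-monoʳ-∣ : ∀ m {n o} → n ∣ o → lcm m n ∣ lcm m o
lcm-monoʳ-∣ m n∣o = lcm-least (m∣lcm[m,n] m _) (∣-trans n∣o (n∣lcm[m,n] m _))

gcd[m,n]∣lcm[m,o] : ∀ m n o → gcd m n ∣ lcm m o
gcd[m,n]∣lcm[m,o] m n o = ∣-trans (gcd[m,n]∣m m n) (m∣lcm[m,n] m o)

m+n≤m*n+1 : ∀ m n .{{_ : NonZero m}} .{{_ : NonZero n}} → m ℕ.+ n ≤ m * n ℕ.+ 1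
m+n≤m*n+1 (suc m) (suc n) = begin
  suc m ℕ.+ suc n         ≡⟨ ℕ-Solver.solve (m ∷ n ∷ []) ⟩
  suc n ℕ.+ m ℕ.+ 1       ≤⟨ +-monoˡ-≤ 1 (+-monoʳ-≤ (suc n) (m≤m*n m (suc n))) ⟩
  suc n ℕ.+ m * suc n ℕ.+ 1 ∎
  where open ≤-Reasoning

m*n+[o+p]≤m*o+n*p+1 : ∀ {m n o p} .{{_ : NonZero m}} .{{_ : NonZero n}} .{{_ : NonZero o}} →
  m ≤ p → m * n ℕ.+ (o ℕ.+ p) ≤ (m * o ℕ.+ n * p) ℕ.+ 1
m*n+[o+p]≤m*o+n*p+1 {m} {suc n} {o} {p} m≤p = begin
  m * suc n ℕ.+ (o ℕ.+ p)               ≡⟨ ℕ-Solver.solve (m ∷ n ∷ o ∷ p ∷ []) ⟩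
  (m ℕ.+ o) ℕ.+ (p ℕ.+ m * n)           ≤⟨ +-mono-≤ (m+n≤m*n+1 m o) (+-monoʳ-≤ p (*-monoˡ-≤ n m≤p)) ⟩
  (m * o ℕ.+ 1) ℕ.+ (p ℕ.+ p * n)       ≡⟨ ℕ-Solver.solve (m ∷ n ∷ o ∷ p ∷ []) ⟩
  (m * o ℕ.+ suc n * p) ℕ.+ 1           ∎
  where open ≤-Reasoning

*-cancel-quotients : ∀ {x y u v k} .{{_ : NonZero (x * y)}} →
  (u * x) * (v * y) ≡ k * (x * y) → u * v ≡ k
*-cancel-quotients {x} {y} {u} {v} {k} eq = *-cancelʳ-≡ (u * v) k (x * y) (begin
  (u * v) * (x * y)   ≡⟨ ℕ-Solver.solve (u ∷ v ∷ x ∷ y ∷ []) ⟩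
  (u * x) * (v * y)   ≡⟨ eq ⟩
  k * (x * y)         ∎)
  where open ≡-Reasoning

i+j≤k+l⇒i-l≤k-j : ∀ {i j k l : ℤ} → i + j ℤ.≤ k + l → i - l ℤ.≤ k - j
i+j≤k+l⇒i-l≤k-j {i} {j} {k} {l} le = begin
  i - l                 ≡⟨ ℤ-Solver.solve (i ∷ j ∷ l ∷ []) ⟩
  (i + j) - (j + l)     ≤⟨ ℤ.+-monoˡ-≤ (ℤ.- (j + l)) le ⟩
  (k + l) - (j + l)     ≡⟨ ℤ-Solver.solve (j ∷ k ∷ l ∷ []) ⟩
  k - j                 ∎
  where open ℤ.≤-Reasoning

proposition4p5 : (a b c : ℕ) → .{{_ : NonZero a}} → .{{_ : NonZero b}} → .{{_ : NonZero c}} → b ∣ c →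
    (+ gcd a c + + lcm a c) - (+ gcd a b + + lcm a b) ≥ + (c / b) - + 1
proposition4p5 a b .(k * b) b∣c@(divides k refl) rewrite m*n/n≡m k b {{it}}
  with gcd-monoʳ-∣ a b∣c | lcm-monoʳ-∣ a b∣c
... | g∣g'@(divides u g'≡u*g) | L∣L'@(divides v L'≡v*L) =
  i+j≤k+l⇒i-l≤k-j {+ k} {+ (g ℕ.+ L)} {+ (g' ℕ.+ L')} {+ 1}
    (ℤ.+≤+ (subst₂ (λ s t → s ℕ.+ (g ℕ.+ L) ≤ t ℕ.+ 1) u*v≡k u*g+v*L≡g'+L' bound))
  where
  g = gcd a b ; L = lcm a b ; g' = gcd a (k * b) ; L' = lcm a (k * b)

  bound : u * v ℕ.+ (g ℕ.+ L) ≤ (u * g ℕ.+ v * L) ℕ.+ 1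
  -- NonZero proofs are passed explicitly: instance search gets stuck comparing gcd and lcm terms.
  bound = m*n+[o+p]≤m*o+n*p+1
    {{quotient≢0 g∣g' {{gcd≢0ˡ a (k * b)}}}} {{quotient≢0 L∣L' {{lcm≢0 a (k * b)}}}} {{gcd≢0ˡ a b}}
    (∣⇒≤ {{lcm≢0 a b}} (∣-trans (quotient-∣ g∣g') (gcd[m,n]∣lcm[m,o] a (k * b) b)))

  u*g+v*L≡g'+L' : u * g ℕ.+ v * L ≡ g' ℕ.+ L'
  u*g+v*L≡g'+L' = sym (cong₂ ℕ._+_ g'≡u*g L'≡v*L)

  u*v≡k : u * v ≡ k
  u*v≡k = *-cancel-quotients {g} {L} {u} {v} {{gcd*lcm≢0 a b}} (begin
    (u * g) * (v * L)  ≡⟨ sym (cong₂ _*_ g'≡u*g L'≡v*L) ⟩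
    g' * L'            ≡⟨ gcd*lcm a (k * b) ⟩
    a * (k * b)        ≡⟨ ℕ-Solver.solve (a ∷ k ∷ b ∷ []) ⟩
    k * (a * b)        ≡⟨ cong (k *_) (sym (gcd*lcm a b)) ⟩
    k * (g * L)        ∎)
    where open ≡-Reasoning
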